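{- Let $\mathcal{S}=(S,r,\phi)$ be a stochastic monotone binary system and let $\mu$ be the number of its mincuts. Then the level of separability $d$ of $\mathcal{S}$ is well defined and satisfies $d\le\mu$.
   Context: A stochastic binary system is $\mathcal{S}=(S,r,\phi)$ with $S=\{1,\dots,N\}$, states $\Omega=\{0,1\}^N$, a probability measure $r$ on $\Omega$ and structure function $\phi:\Omega\to\{0,1\}$; states with $\phi=1$ are pathsets and states with $\phi=0$ are cutsets. It is monotone (SMBS) if $\phi$ is non-decreasing for the componentwise order on $\Omega$, $\phi(\mathbf 0)=0$ and $\phi(\mathbf 1)=1$. A mincut is a cutset $\omega$ such that $\phi(\sigma)=1$ for every $\sigma>\omega$. The level of separability of $\mathcal{S}$ is the least positive integer $d$ such that either (i) there exist $d$ hyperplanes with non-negative normal vectors $n^1,\dots,n^d\in[0,\infty)^N$ and thresholds $\alpha_1,\dots,\alpha_d$ such that the pathsets are exactly the states $x\in\Omega$ lying in the intersection of the positive half-spaces $\langle n^k,x\rangle\ge\alpha_k$, $k=1,\dots,d$; or (ii) there exist $d$ such hyperplanes such that the cutsets are exactly the states lying in the intersection of the opposite half-spaces $\langle n^k,x\rangle\le\alpha_k$, $k=1,\dots,d$. -}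

module Defs where

open import Data.Bool as B using (Bool; true; false)
open import Data.Nat using (ℕ)
open import Data.Fin using (Fin)
open import Data.Vec using (Vec; []; _∷_; replicate)
open import Data.Vec.Relation.Binary.Pointwise.Inductive using (Pointwise)
open import Data.Rational as Q using (ℚ; 0ℚ; _+_)
open import Data.Product using (_×_)
open import Data.Sum using (_⊎_)
open import Relation.Binary.PropositionalEquality using (_≡_; _≢_)
open import Relation.Nullary using (¬_)
open import Function.Bundles using (_⇔_)

-- States Ω = {0,1}^N, as boolean vectors (true = component works).
State : ℕ → Set
State N = Vec Bool N

_≤Ω_ : ∀ {N} → State N → State N → Set
x ≤Ω y = Pointwise B._≤_ x y

_<Ω_ : ∀ {N} → State N → State N → Set
x <Ω y = (x ≤Ω y) × (x ≢ y)

IsMonotone : ∀ {N} → (State N → Bool) → Set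
IsMonotone {N} φ =
  (∀ x y → x ≤Ω y → φ x B.≤ φ y)
  × (φ (replicate N false) ≡ false)
  × (φ (replicate N true) ≡ true)

IsMincut : ∀ {N} → (State N → Bool) → State N → Set
IsMincut φ ω = (φ ω ≡ false) × (∀ σ → ω <Ω σ → φ σ ≡ true)

inner : ∀ {N} → Vec ℚ N → State N → ℚ
inner []       []           = 0ℚ
inner (a ∷ as) (true  ∷ xs) = a + inner as xs
inner (a ∷ as) (false ∷ xs) = inner as xs

NonNeg : ∀ {N} → Vec ℚ N → Set
NonNeg v = Data.Vec.Relation.Unary.All.All (λ a → 0ℚ Q.≤ a) v
  where import Data.Vec.Relation.Unary.All

PathSeparable : ∀ {N} → (State N → Bool) → ℕ → Set
PathSeparable {N} φ d =
  Data.Product.Σ (Fin d → Vec ℚ N) λ n → Data.Product.Σ (Fin d → ℚ) λ α →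
    (∀ k → NonNeg (n k))
    × (∀ x → (φ x ≡ true) ⇔ (∀ k → α k Q.≤ inner (n k) x))
  where import Data.Product

CutSeparable : ∀ {N} → (State N → Bool) → ℕ → Set
CutSeparable {N} φ d =
  Data.Product.Σ (Fin d → Vec ℚ N) λ n → Data.Product.Σ (Fin d → ℚ) λ α →
    (∀ k → NonNeg (n k))
    × (∀ x → (φ x ≡ false) ⇔ (∀ k → inner (n k) x Q.≤ α k))
  where import Data.Product

Separable : ∀ {N} → (State N → Bool) → ℕ → Set
Separable φ d = PathSeparable φ d ⊎ CutSeparable φ d

{-# OPTIONS --safe #-}
module Submission where

open import Defs
open import Data.Bool using (Bool)
open import Data.Nat using (ℕ; _≤_)
open import Data.List using (List; length)
open import Data.List.Relation.Unary.Unique.Propositional using (Unique)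
open import Data.List.Membership.Propositional using (_∈_)
open import Data.Product using (Σ; _×_)
open import Function.Bundles using (_⇔_)

open import Data.Bool as B using (true; false; b≤b; f≤t)
import Data.Bool.Properties as BP
open import Data.Nat as ℕ using (_<_; s≤s; z≤n)
import Data.Nat.Properties as ℕP
open import Data.Nat.Induction using (<-wellFounded)
open import Data.Fin using (Fin; zero; suc)
open import Data.Fin.Properties using (any?; toℕ<n)
open import Data.Vec using (Vec; []; _∷_; lookup)
open import Data.Vec.Relation.Binary.Pointwise.Inductive as Pointwise using ([]; _∷_)
open import Data.Vec.Relation.Unary.All using ([]; _∷_)
open import Data.Rational as ℚ using (ℚ; 0ℚ; 1ℚ; _+_)
import Data.Rational.Properties as ℚP
import Data.List as List
open import Data.List.Relation.Unary.Any using (index)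
open import Data.List.Relation.Unary.Any.Properties using (lookup-index)
open import Data.List.Membership.Propositional.Properties using (∈-lookup)
open import Data.Product using (_,_; ∃)
open import Data.Sum as Sum using (_⊎_; inj₁; inj₂)
open import Induction.WellFounded using (Acc; acc)
open import Relation.Nullary using (¬_; Dec; yes; no; contradiction)
open import Relation.Nullary.Decidable using (_×-dec_)
open import Relation.Binary.PropositionalEquality using (_≡_; refl; sym; cong; subst)
open import Function.Bundles using (mk⇔; Equivalence)
open Equivalence using (to; from)
open import Function.Properties.Equivalence using () renaming (sym to ⇔-sym)
open import Function.Related.Propositional using (module EquationalReasoning)

-- Every cutset lies below a mincut (raise failed components one at a time while the
-- state stays a cutset). Hence x is a pathset iff x lies below no mincut ω, and
-- "x ≰ ω" is the half-space ⟨n^ω, x⟩ ≥ 1, where n^ω is the indicator vector of the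
-- components that fail in ω. These μ half-spaces separate the pathsets, and μ ≥ 1
-- because the all-failed state is a cutset.

variable
  n : ℕ

≤Ω-refl : {x : State n} → x ≤Ω x
≤Ω-refl = Pointwise.refl BP.≤-refl

≤Ω-trans : {x y z : State n} → x ≤Ω y → y ≤Ω z → x ≤Ω z
≤Ω-trans = Pointwise.trans BP.≤-trans

raise : State n → Fin n → State n
raise (_ ∷ xs) zero    = true ∷ xs
raise (x ∷ xs) (suc i) = x ∷ raise xs i

≤Ω-raise : (z : State n) (i : Fin n) → z ≤Ω raise z i
≤Ω-raise (x ∷ xs) zero    = BP.≤-maximum x ∷ ≤Ω-refl
≤Ω-raise (x ∷ xs) (suc i) = BP.≤-refl ∷ ≤Ω-raise xs i

raise-≤Ω : {z σ : State n} (i : Fin n) → lookup σ i ≡ true → z ≤Ω σ → raise z i ≤Ω σ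
raise-≤Ω zero    refl (_ ∷ z≤σ)   = b≤b ∷ z≤σ
raise-≤Ω (suc i) σᵢ   (b ∷ z≤σ)   = b ∷ raise-≤Ω i σᵢ z≤σ

<Ω⇒∃-false-true : {z σ : State n} → z <Ω σ → ∃ λ i → (lookup z i ≡ false) × (lookup σ i ≡ true)
<Ω⇒∃-false-true ([] , z≢σ)          = contradiction refl z≢σ
<Ω⇒∃-false-true ((f≤t ∷ _) , _)     = zero , refl , refl
<Ω⇒∃-false-true {z = b ∷ _} ((b≤b ∷ z≤σ) , z≢σ)
  with <Ω⇒∃-false-true (z≤σ , λ zs≡σs → z≢σ (cong (b ∷_) zs≡σs))
... | i , zᵢ , σᵢ = suc i , zᵢ , σᵢ

failures : State n → ℕ
failures []           = 0
failures (false ∷ xs) = ℕ.suc (failures xs)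
failures (true ∷ xs)  = failures xs

failures-raise : (z : State n) (i : Fin n) → lookup z i ≡ false → failures (raise z i) < failures z
failures-raise (false ∷ xs) zero    refl = ℕP.n<1+n (failures xs)
failures-raise (false ∷ xs) (suc i) zᵢ   = s≤s (failures-raise xs i zᵢ)
failures-raise (true ∷ xs)  (suc i) zᵢ   = failures-raise xs i zᵢ

module Monotone (φ : State n → Bool) (mono : ∀ x y → x ≤Ω y → φ x B.≤ φ y) where

  pathset-mono : {x y : State n} → φ x ≡ true → x ≤Ω y → φ y ≡ true
  pathset-mono {x} {y} φx x≤y =
    sym (BP.≤-antisym (subst (B._≤ φ y) φx (mono x y x≤y)) (BP.≤-maximum (φ y)))

  CutsetAfterRaise : State n → Set
  CutsetAfterRaise z = ∃ λ i → (lookup z i ≡ false) × (φ (raise z i) ≡ false)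

  cutsetAfterRaise? : (z : State n) → Dec (CutsetAfterRaise z)
  cutsetAfterRaise? z = any? λ i → (lookup z i B.≟ false) ×-dec (φ (raise z i) B.≟ false)

  -- It suffices to test the immediate successors raise z i, by monotonicity.
  ¬cutsetAfterRaise⇒mincut : {z : State n} → φ z ≡ false → ¬ CutsetAfterRaise z → IsMincut φ z
  ¬cutsetAfterRaise⇒mincut {z} φz stuck = φz , pathset-above
    where
    pathset-above : ∀ σ → z <Ω σ → φ σ ≡ true
    pathset-above σ z<σ@(z≤σ , _) with <Ω⇒∃-false-true z<σ
    ... | i , zᵢ , σᵢ with φ (raise z i) in φzᵢ
    ...   | false = contradiction (i , zᵢ , φzᵢ) stuck
    ...   | true  = pathset-mono φzᵢ (raise-≤Ω i σᵢ z≤σ)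

  cutset-below-mincut : {z : State n} → φ z ≡ false → ∃ λ ω → (z ≤Ω ω) × IsMincut φ ω
  cutset-below-mincut {z} = go z (<-wellFounded (failures z))
    where
    go : ∀ z → Acc _<_ (failures z) → φ z ≡ false → ∃ λ ω → (z ≤Ω ω) × IsMincut φ ω
    go z (acc rec) φz with cutsetAfterRaise? z
    ... | no stuck = z , ≤Ω-refl , ¬cutsetAfterRaise⇒mincut φz stuck
    ... | yes (i , zᵢ , φzᵢ) with go (raise z i) (rec (failures-raise z i zᵢ)) φzᵢ
    ...   | ω , zᵢ≤ω , ω-mincut = ω , ≤Ω-trans (≤Ω-raise z i) zᵢ≤ω , ω-mincut

  pathset⇔below-no-mincut : (x : State n) → (φ x ≡ true) ⇔ (∀ ω → IsMincut φ ω → ¬ x ≤Ω ω)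
  pathset⇔below-no-mincut x = mk⇔ below-none pathset
    where
    below-none : φ x ≡ true → ∀ ω → IsMincut φ ω → ¬ x ≤Ω ω
    below-none φx ω (φω , _) x≤ω with () ← subst (_≡ true) φω (pathset-mono φx x≤ω)
    pathset : (∀ ω → IsMincut φ ω → ¬ x ≤Ω ω) → φ x ≡ true
    pathset below-none with φ x in φx
    ... | true  = refl
    ... | false with cutset-below-mincut φx
    ...   | ω , x≤ω , ω-mincut = contradiction x≤ω (below-none ω ω-mincut)

failureIndicator : State n → Vec ℚ n
failureIndicator []           = []
failureIndicator (true ∷ ω)   = 0ℚ ∷ failureIndicator ω
failureIndicator (false ∷ ω)  = 1ℚ ∷ failureIndicator ω

0≤1 : 0ℚ ℚ.≤ 1ℚ
0≤1 = ℚP.nonNegative⁻¹ 1ℚ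

1≰0 : ¬ (1ℚ ℚ.≤ 0ℚ)
1≰0 1≤0 = ℚP.1≢0 (ℚP.≤-antisym 1≤0 0≤1)

1≤1+q : {q : ℚ} → 0ℚ ℚ.≤ q → 1ℚ ℚ.≤ 1ℚ + q
1≤1+q {q} 0≤q = subst (ℚ._≤ 1ℚ + q) (ℚP.+-identityʳ 1ℚ) (ℚP.+-monoʳ-≤ 1ℚ 0≤q)

failureIndicator-nonNeg : (ω : State n) → NonNeg (failureIndicator ω)
failureIndicator-nonNeg []          = []
failureIndicator-nonNeg (true ∷ ω)  = ℚP.≤-refl ∷ failureIndicator-nonNeg ω
failureIndicator-nonNeg (false ∷ ω) = 0≤1 ∷ failureIndicator-nonNeg ω

inner-nonNeg : {v : Vec ℚ n} → NonNeg v → (x : State n) → 0ℚ ℚ.≤ inner v x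
inner-nonNeg []           []           = ℚP.≤-refl
inner-nonNeg (_ ∷ v≥0)    (false ∷ x)  = inner-nonNeg v≥0 x
inner-nonNeg (a≥0 ∷ v≥0)  (true ∷ x)   = ℚP.+-mono-≤ a≥0 (inner-nonNeg v≥0 x)

inner-failureIndicator-≤Ω : {x ω : State n} → x ≤Ω ω → inner (failureIndicator ω) x ≡ 0ℚ
inner-failureIndicator-≤Ω {x = []}        []            = refl
inner-failureIndicator-≤Ω {x = false ∷ _} (f≤t ∷ x≤ω)   = inner-failureIndicator-≤Ω x≤ω
inner-failureIndicator-≤Ω {x = false ∷ _} (b≤b ∷ x≤ω)   = inner-failureIndicator-≤Ω x≤ω
inner-failureIndicator-≤Ω {x = true ∷ _}  (b≤b ∷ x≤ω)   =
  subst (_≡ 0ℚ) (sym (ℚP.+-identityˡ _)) (inner-failureIndicator-≤Ω x≤ω)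

≤Ω⊎1≤inner-failureIndicator : (x ω : State n) → (x ≤Ω ω) ⊎ (1ℚ ℚ.≤ inner (failureIndicator ω) x)
≤Ω⊎1≤inner-failureIndicator []          []          = inj₁ []
≤Ω⊎1≤inner-failureIndicator (true ∷ x)  (false ∷ ω) = inj₂ (1≤1+q (inner-nonNeg (failureIndicator-nonNeg ω) x))
≤Ω⊎1≤inner-failureIndicator (true ∷ x)  (true ∷ ω)  =
  Sum.map (b≤b ∷_) (subst (1ℚ ℚ.≤_) (sym (ℚP.+-identityˡ _))) (≤Ω⊎1≤inner-failureIndicator x ω)
≤Ω⊎1≤inner-failureIndicator (false ∷ x) (true ∷ ω)  = Sum.map₁ (f≤t ∷_) (≤Ω⊎1≤inner-failureIndicator x ω)
≤Ω⊎1≤inner-failureIndicator (false ∷ x) (false ∷ ω) = Sum.map₁ (b≤b ∷_) (≤Ω⊎1≤inner-failureIndicator x ω)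

≰Ω⇔1≤inner-failureIndicator : (x ω : State n) → (¬ x ≤Ω ω) ⇔ (1ℚ ℚ.≤ inner (failureIndicator ω) x)
≰Ω⇔1≤inner-failureIndicator x ω = mk⇔ above below
  where
  above : ¬ x ≤Ω ω → 1ℚ ℚ.≤ inner (failureIndicator ω) x
  above x≰ω with ≤Ω⊎1≤inner-failureIndicator x ω
  ... | inj₁ x≤ω = contradiction x≤ω x≰ω
  ... | inj₂ 1≤  = 1≤
  below : 1ℚ ℚ.≤ inner (failureIndicator ω) x → ¬ x ≤Ω ω
  below 1≤ x≤ω = 1≰0 (subst (1ℚ ℚ.≤_) (inner-failureIndicator-≤Ω x≤ω) 1≤)

∀∈⇔∀lookup : {A : Set} {P : A → Set} (xs : List A) →
  (∀ a → a ∈ xs → P a) ⇔ (∀ k → P (List.lookup xs k))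
∀∈⇔∀lookup {P = P} xs = mk⇔
  (λ ∀∈ k → ∀∈ _ (∈-lookup k))
  (λ ∀k a a∈xs → subst P (sym (lookup-index a∈xs)) (∀k (index a∈xs)))

Π-cong : {A : Set} {P Q : A → Set} → (∀ a → P a ⇔ Q a) → (∀ a → P a) ⇔ (∀ a → Q a)
Π-cong P⇔Q = mk⇔ (λ ∀P a → to (P⇔Q a) (∀P a)) (λ ∀Q a → from (P⇔Q a) (∀Q a))

→-congˡ : {A B C : Set} → A ⇔ B → (A → C) ⇔ (B → C)
→-congˡ A⇔B = mk⇔ (λ f b → f (from A⇔B b)) (λ g a → g (to A⇔B a))

proposition2 : (N : ℕ) (φ : State N → Bool) → IsMonotone φ →
    (mincuts : List (State N)) → Unique mincuts →
    (∀ ω → (ω ∈ mincuts) ⇔ IsMincut φ ω) →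
    Σ ℕ λ d → (1 ≤ d) × (d ≤ length mincuts) × Separable φ d
-- Uniqueness of the list is what makes length mincuts equal to μ; the proof does not need it.
proposition2 N φ (mono , φ𝟎 , _) mincuts _ listed =
  length mincuts , nonempty , ℕP.≤-refl , inj₁ (normal , (λ _ → 1ℚ) , normal-nonNeg , separates)
  where
  open Monotone φ mono
  normal : Fin (length mincuts) → Vec ℚ N
  normal k = failureIndicator (List.lookup mincuts k)
  normal-nonNeg : ∀ k → NonNeg (normal k)
  normal-nonNeg k = failureIndicator-nonNeg (List.lookup mincuts k)
  nonempty : 1 ≤ length mincuts
  nonempty with cutset-below-mincut φ𝟎
  ... | ω , _ , ω-mincut = ℕP.≤-trans (s≤s z≤n) (toℕ<n (index (from (listed ω) ω-mincut)))
  separates : ∀ x → (φ x ≡ true) ⇔ (∀ k → 1ℚ ℚ.≤ inner (normal k) x)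
  separates x = begin
    φ x ≡ true                                        ∼⟨ pathset⇔below-no-mincut x ⟩
    (∀ ω → IsMincut φ ω → ¬ x ≤Ω ω)                   ∼⟨ Π-cong (λ ω → →-congˡ (⇔-sym (listed ω))) ⟩
    (∀ ω → ω ∈ mincuts → ¬ x ≤Ω ω)                    ∼⟨ ∀∈⇔∀lookup mincuts ⟩
    (∀ k → ¬ x ≤Ω List.lookup mincuts k)              ∼⟨ Π-cong (λ k → ≰Ω⇔1≤inner-failureIndicator x _) ⟩
    (∀ k → 1ℚ ℚ.≤ inner (normal k) x)                 ∎
    where open EquationalReasoning
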